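{- Let $a$, $b$, $d$ be positive integers with $\gcd(a,b^{2})$ squarefree. If $db^{4}-a^{2}=n^{2}$ for some positive integer $n$, then every prime divisor of $b$ is congruent to $1\bmod 4$. -}

module Defs where

open import Data.Nat using (ℕ; _*_; _≤_)
open import Data.Nat.Divisibility using (_∣_)
open import Relation.Nullary using (¬_)

SquareFree : ℕ → Set
SquareFree m = ∀ k → 2 ≤ k → ¬ (k * k ∣ m)

-- For a prime p = 2 or p ≡ 3 (mod 4), p² ∣ x² + y² forces p ∣ x and p ∣ y: for
-- p = 2 because squares are 0 or 1 mod 4, for p ≡ 3 (mod 4) because −1 is not a
-- square mod p (by Fermat's little theorem, itself a consequence of p ∣ (p choose k)
-- for 0 < k < p). If such a p divides b, then p⁴ ∣ d b⁴ = a² + n², and applying this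
-- twice gives p² ∣ a; so p² ∣ gcd(a, b²), contradicting squarefreeness.
module Submission where

open import Defs
open import Data.Nat
open import Data.Nat.Properties
open import Data.Nat.Divisibility
open import Data.Nat.DivMod
open import Data.Nat.GCD using (gcd; gcd-greatest)
open import Data.Nat.Primality
open import Data.Nat.Combinatorics
open import Data.Nat.Combinatorics.Specification using (nCk≡n!/k![n-k]!)
open import Data.Nat.Tactic.RingSolver using (solve-∀)
open import Data.Fin using (Fin; zero; suc; toℕ)
open import Data.Fin.Properties using (toℕ-inject₁; toℕ-fromℕ; toℕ<n)
open import Data.Vec.Functional using (Vector; init; last; tail)
open import Data.Product using (_×_; _,_; proj₁)
open import Data.Sum using (inj₁; inj₂)
open import Relation.Nullary using (¬_; yes; no; contradiction)
open import Relation.Binary.PropositionalEquality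
open import Algebra.Definitions.RawMonoid +-0-rawMonoid using () renaming (_×_ to _×ᴹ_)
open import Algebra.Definitions.RawSemiring +-*-rawSemiring using () renaming (_^_ to _^ᴿ_)
open import Algebra.Properties.Monoid.Sum +-0-monoid using (sum; sum⁺-syntax; sum-cong-≗; sum-init-last)
import Algebra.Properties.CommutativeSemiring.Binomial +-*-commutativeSemiring as Binomial

×ᴹ≡* : ∀ n x → n ×ᴹ x ≡ n * x
×ᴹ≡* zero    x = refl
×ᴹ≡* (suc n) x = cong (x +_) (×ᴹ≡* n x)

^ᴿ≡^ : ∀ x n → x ^ᴿ n ≡ x ^ n
^ᴿ≡^ x zero    = refl
^ᴿ≡^ x (suc n) = cong (x *_) (^ᴿ≡^ x n)

binomial-theorem : ∀ n x y →
                   (x + y) ^ n ≡ ∑[ k ≤ n ] ((n C toℕ k) * (x ^ toℕ k * y ^ (n ∸ toℕ k)))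
binomial-theorem n x y =
  trans (sym (^ᴿ≡^ (x + y) n)) (trans (Binomial.theorem n x y) (sum-cong-≗ {suc n} term≡))
  where
  term≡ : ∀ k → (n C toℕ k) ×ᴹ (x ^ᴿ toℕ k * y ^ᴿ (n ∸ toℕ k))
              ≡ (n C toℕ k) * (x ^ toℕ k * y ^ (n ∸ toℕ k))
  term≡ k = trans (×ᴹ≡* (n C toℕ k) _)
                  (cong₂ (λ u v → (n C toℕ k) * (u * v)) (^ᴿ≡^ x (toℕ k)) (^ᴿ≡^ y (n ∸ toℕ k)))

∣-sum : ∀ {d n} (f : Vector ℕ n) → (∀ i → d ∣ f i) → d ∣ sum f
∣-sum {d} {zero}  f d∣f = d ∣0
∣-sum {d} {suc n} f d∣f = ∣m∣n⇒∣m+n (d∣f zero) (∣-sum (tail f) (λ i → d∣f (suc i)))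

+-cong-% : ∀ {m n o q d} .{{_ : NonZero d}} →
           m % d ≡ n % d → o % d ≡ q % d → (m + o) % d ≡ (n + q) % d
+-cong-% {m} {n} {o} {q} {d} m≡n o≡q = begin
  (m + o) % d             ≡⟨ %-distribˡ-+ m o d ⟩
  (m % d + o % d) % d     ≡⟨ cong₂ (λ u v → (u + v) % d) m≡n o≡q ⟩
  (n % d + q % d) % d     ≡⟨ %-distribˡ-+ n q d ⟨
  (n + q) % d             ∎
  where open ≡-Reasoning

*-congˡ-% : ∀ o {m n d} .{{_ : NonZero d}} → m % d ≡ n % d → (o * m) % d ≡ (o * n) % d
*-congˡ-% o {m} {n} {d} m≡n = begin
  (o * m) % d             ≡⟨ %-distribˡ-* o m d ⟩
  (o % d * (m % d)) % d   ≡⟨ cong (λ u → (o % d * u) % d) m≡n ⟩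
  (o % d * (n % d)) % d   ≡⟨ %-distribˡ-* o n d ⟨
  (o * n) % d             ∎
  where open ≡-Reasoning

^-monoˡ-∣ : ∀ {m n} k → m ∣ n → m ^ k ∣ n ^ k
^-monoˡ-∣ zero    m∣n = ∣-refl
^-monoˡ-∣ (suc k) m∣n = *-pres-∣ m∣n (^-monoˡ-∣ k m∣n)

prime⇒>1 : ∀ {p} → Prime p → 1 < p
prime⇒>1 {p} pp = nonTrivial⇒n>1 p {{prime⇒nonTrivial pp}}

prime∣x²⇒∣x : ∀ {p x} → Prime p → p ∣ x ^ 2 → p ∣ x
prime∣x²⇒∣x {x = x} pp p∣x² with euclidsLemma x (x * 1) pp p∣x²
... | inj₁ p∣x   = p∣x
... | inj₂ p∣x*1 = subst (_ ∣_) (*-identityʳ x) p∣x*1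

prime∤m! : ∀ {p} → Prime p → ∀ m → m < p → ¬ p ∣ m !
prime∤m! pp zero    _   p∣1 = <⇒≢ (prime⇒>1 pp) (sym (∣1⇒≡1 p∣1))
prime∤m! pp (suc m) m<p p∣m! with euclidsLemma (suc m) (m !) pp p∣m!
... | inj₁ p∣1+m = <⇒≱ m<p (∣⇒≤ p∣1+m)
... | inj₂ p∣m!  = prime∤m! pp m (<-trans (n<1+n m) m<p) p∣m!

n!≡nCk*k!*[n∸k]! : ∀ {n k} → k ≤ n → n ! ≡ (n C k) * (k ! * (n ∸ k) !)
n!≡nCk*k!*[n∸k]! {n} {k} k≤n = sym (begin
  (n C k) * (k ! * (n ∸ k) !)                    ≡⟨ cong (_* (k ! * (n ∸ k) !)) (nCk≡n!/k![n-k]! k≤n) ⟩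
  n ! / (k ! * (n ∸ k) !) * (k ! * (n ∸ k) !)    ≡⟨ m/n*n≡m (k![n∸k]!∣n! k≤n) ⟩
  n !                                            ∎)
  where open ≡-Reasoning
        instance _ = k !* (n ∸ k) !≢0

prime∣pCk : ∀ {p k} → Prime p → 0 < k → k < p → p ∣ p C k
prime∣pCk {suc q} {k} pp 0<k k<p
  with euclidsLemma (suc q C k) (k ! * (suc q ∸ k) !) pp p∣[pCk]*k!*[p∸k]!
  where p∣[pCk]*k!*[p∸k]! = subst (suc q ∣_) (n!≡nCk*k!*[n∸k]! (<⇒≤ k<p)) (m∣m*n (q !))
... | inj₁ p∣pCk = p∣pCk
... | inj₂ p∣k!*[p∸k]! with euclidsLemma (k !) ((suc q ∸ k) !) pp p∣k!*[p∸k]!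
...   | inj₁ p∣k!     = contradiction p∣k! (prime∤m! pp k k<p)
...   | inj₂ p∣[p∸k]! =
  contradiction p∣[p∸k]! (prime∤m! pp (suc q ∸ k) (∸-monoʳ-< 0<k (<⇒≤ k<p)))

frobenius-% : ∀ {p} .{{_ : NonZero p}} → Prime p → ∀ x y → (x + y) ^ p % p ≡ (x ^ p + y ^ p) % p
frobenius-% {p@(suc q)} pp x y = begin
  (x + y) ^ p % p                                   ≡⟨ cong (_% p) (binomial-theorem p x y) ⟩
  (term zero + sum (tail term)) % p                 ≡⟨ cong (λ s → (term zero + s) % p) (sum-init-last (tail term)) ⟩
  (term zero + (sum middle + last (tail term))) % p ≡⟨ cong₂ (λ u v → (u + (sum middle + v)) % p) first≡ last≡ ⟩
  (y ^ p + (sum middle + x ^ p)) % p                ≡⟨ cong (_% p) (rearrange (y ^ p) (sum middle) (x ^ p)) ⟩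
  (sum middle + (x ^ p + y ^ p)) % p                ≡⟨ %-remove-+ˡ (x ^ p + y ^ p) (∣-sum middle p∣middle) ⟩
  (x ^ p + y ^ p) % p                               ∎
  where
  open ≡-Reasoning
  term : Fin (suc p) → ℕ
  term k = (p C toℕ k) * (x ^ toℕ k * y ^ (p ∸ toℕ k))
  middle : Fin q → ℕ
  middle = init (tail term)
  first≡ : term zero ≡ y ^ p
  first≡ = trans (*-identityˡ _) (*-identityˡ _)
  last≡ : last (tail term) ≡ x ^ p
  last≡ rewrite toℕ-fromℕ q | nCn≡1 p | n∸n≡0 p = trans (*-identityˡ _) (*-identityʳ _)
  p∣middle : ∀ i → p ∣ middle i
  p∣middle i = ∣m⇒∣m*n _ (prime∣pCk pp (s≤s z≤n) (s≤s (subst (_< q) (sym (toℕ-inject₁ i)) (toℕ<n i))))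
  rearrange : ∀ a b c → a + (b + c) ≡ b + (c + a)
  rearrange = solve-∀

fermat-% : ∀ {p} .{{_ : NonZero p}} → Prime p → ∀ x → x ^ p % p ≡ x % p
fermat-% {suc _} pp zero    = refl
fermat-% {p}     pp (suc x) = begin
  (1 + x) ^ p % p      ≡⟨ cong (λ z → z ^ p % p) (+-comm 1 x) ⟩
  (x + 1) ^ p % p      ≡⟨ frobenius-% pp x 1 ⟩
  (x ^ p + 1 ^ p) % p  ≡⟨ +-cong-% (fermat-% pp x) (cong (_% p) (^-zeroˡ p)) ⟩
  (x + 1) % p          ≡⟨ cong (_% p) (+-comm x 1) ⟩
  (1 + x) % p          ∎
  where open ≡-Reasoning

m+n∣m^odd+n^odd : ∀ m n k → m + n ∣ m ^ suc (k * 2) + n ^ suc (k * 2)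
m+n∣m^odd+n^odd m n zero    =
  subst₂ (λ u v → m + n ∣ u + v) (sym (*-identityʳ m)) (sym (*-identityʳ n)) ∣-refl
m+n∣m^odd+n^odd m n (suc k) =
  ∣m+n∣m⇒∣n (subst (m + n ∣_) (expand m n U V) (m∣m*n (m * U + n * V)))
            (∣n⇒∣m*n (m * n) (m+n∣m^odd+n^odd m n k))
  where
  U = m ^ suc (k * 2)
  V = n ^ suc (k * 2)
  expand : ∀ m n U V → (m + n) * (m * U + n * V) ≡ m * n * (U + V) + (m * (m * U) + n * (n * V))
  expand = solve-∀

-- With p = 2e + 1 and e odd, x² + y² divides (x²)ᵉ + (y²)ᵉ; multiplying by xy and
-- using xᵖ = x (x²)ᵉ ≡ x (mod p) turns this into p ∣ 2xy.
prime≡3mod4∣x²+y²⇒∣2xy : ∀ {p} .{{_ : NonZero p}} → Prime p → p % 4 ≡ 3 →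
                          ∀ x y → p ∣ x ^ 2 + y ^ 2 → p ∣ 2 * (x * y)
prime≡3mod4∣x²+y²⇒∣2xy {p} pp p%4≡3 x y p∣x²+y² = m%n≡0⇒n∣m (2 * (x * y)) p (begin
  2 * (x * y) % p                                     ≡⟨ cong (_% p) (double x y) ⟩
  (y * x + x * y) % p                                 ≡⟨ +-cong-% (*-congˡ-% y (fermat-% pp x)) (*-congˡ-% x (fermat-% pp y)) ⟨
  (y * x ^ p + x * y ^ p) % p                         ≡⟨ cong₂ (λ u v → (y * u + x * v) % p) (x^p≡x*[x²]^e x) (x^p≡x*[x²]^e y) ⟩
  (y * (x * (x ^ 2) ^ e) + x * (y * (y ^ 2) ^ e)) % p ≡⟨ cong (_% p) (factor x y ((x ^ 2) ^ e) ((y ^ 2) ^ e)) ⟩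
  x * y * ((x ^ 2) ^ e + (y ^ 2) ^ e) % p             ≡⟨ n∣m⇒m%n≡0 _ p (∣n⇒∣m*n (x * y) p∣x²ᵉ+y²ᵉ) ⟩
  0                                                   ∎)
  where
  open ≡-Reasoning
  e = suc (p / 4 * 2)
  p≡1+2e : p ≡ suc (2 * e)
  p≡1+2e = trans (m≡m%n+[m/n]*n p 4) (trans (cong (_+ p / 4 * 4) p%4≡3) (regroup (p / 4)))
    where regroup : ∀ k → 3 + k * 4 ≡ suc (2 * suc (k * 2))
          regroup = solve-∀
  x^p≡x*[x²]^e : ∀ x → x ^ p ≡ x * (x ^ 2) ^ e
  x^p≡x*[x²]^e x = trans (cong (x ^_) p≡1+2e) (cong (x *_) (sym (^-*-assoc x 2 e)))
  p∣x²ᵉ+y²ᵉ : p ∣ (x ^ 2) ^ e + (y ^ 2) ^ e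
  p∣x²ᵉ+y²ᵉ = ∣-trans p∣x²+y² (m+n∣m^odd+n^odd (x ^ 2) (y ^ 2) (p / 4))
  double : ∀ x y → 2 * (x * y) ≡ y * x + x * y
  double = solve-∀
  factor : ∀ x y u v → y * (x * u) + x * (y * v) ≡ x * y * (u + v)
  factor = solve-∀

prime≡3mod4∣x²+y²⇒∣x : ∀ {p} .{{_ : NonZero p}} → Prime p → p % 4 ≡ 3 →
                        ∀ x y → p ∣ x ^ 2 + y ^ 2 → p ∣ x
prime≡3mod4∣x²+y²⇒∣x {p} pp p%4≡3 x y p∣x²+y²
  with euclidsLemma 2 (x * y) pp (prime≡3mod4∣x²+y²⇒∣2xy pp p%4≡3 x y p∣x²+y²)
... | inj₁ p∣2 = contradiction (∣⇒≤ p∣2) (<⇒≱ (subst (_≤ p) p%4≡3 (m%n≤m p 4)))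
... | inj₂ p∣xy with euclidsLemma x y pp p∣xy
...   | inj₁ p∣x = p∣x
...   | inj₂ p∣y = prime∣x²⇒∣x pp (∣m+n∣m⇒∣n (subst (p ∣_) (+-comm (x ^ 2) (y ^ 2)) p∣x²+y²)
                                           (∣m⇒∣m*n (y * 1) p∣y))

SumOfSquaresRigid : ℕ → Set
SumOfSquaresRigid p = ∀ x y → p ^ 2 ∣ x ^ 2 + y ^ 2 → p ∣ x × p ∣ y

prime≡3mod4⇒rigid : ∀ {p} .{{_ : NonZero p}} → Prime p → p % 4 ≡ 3 → SumOfSquaresRigid p
prime≡3mod4⇒rigid {p} pp p%4≡3 x y p²∣x²+y² =
  prime≡3mod4∣x²+y²⇒∣x pp p%4≡3 x y p∣x²+y² ,
  prime≡3mod4∣x²+y²⇒∣x pp p%4≡3 y x (subst (p ∣_) (+-comm (x ^ 2) (y ^ 2)) p∣x²+y²)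
  where p∣x²+y² = m*n∣⇒m∣ p (p * 1) p²∣x²+y²

m^2%4≡[m%2]^2%4 : ∀ m → m ^ 2 % 4 ≡ (m % 2) ^ 2 % 4
m^2%4≡[m%2]^2%4 m = begin
  m ^ 2 % 4                                 ≡⟨ cong (λ z → z ^ 2 % 4) (m≡m%n+[m/n]*n m 2) ⟩
  (r + q * 2) ^ 2 % 4                       ≡⟨ cong (_% 4) (expand r q) ⟩
  (r ^ 2 + (q * q + q * r) * 4) % 4         ≡⟨ [m+kn]%n≡m%n (r ^ 2) (q * q + q * r) 4 ⟩
  r ^ 2 % 4                                 ∎
  where
  open ≡-Reasoning
  r = m % 2
  q = m / 2
  -- Squares are spelled out as x * (x * 1) (which is x ^ 2 by definition)
  -- because solve-∀ does not handle _^_ on ℕ.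
  expand : ∀ a b → (a + b * 2) * ((a + b * 2) * 1) ≡ a * (a * 1) + (b * b + b * a) * 4
  expand = solve-∀

[r^2+s^2]%4≡0⇒r≡s≡0 : ∀ r s → r < 2 → s < 2 → (r ^ 2 + s ^ 2) % 4 ≡ 0 → r ≡ 0 × s ≡ 0
[r^2+s^2]%4≡0⇒r≡s≡0 0 0 _ _ _ = refl , refl
[r^2+s^2]%4≡0⇒r≡s≡0 0 1 _ _ ()
[r^2+s^2]%4≡0⇒r≡s≡0 1 0 _ _ ()
[r^2+s^2]%4≡0⇒r≡s≡0 1 1 _ _ ()
[r^2+s^2]%4≡0⇒r≡s≡0 (2+ _) _ (s≤s (s≤s ())) _ _
[r^2+s^2]%4≡0⇒r≡s≡0 _ (2+ _) _ (s≤s (s≤s ())) _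

rigid[2] : SumOfSquaresRigid 2
rigid[2] x y 4∣x²+y² with [r^2+s^2]%4≡0⇒r≡s≡0 (x % 2) (y % 2) (m%n<n x 2) (m%n<n y 2) (begin
  ((x % 2) ^ 2 + (y % 2) ^ 2) % 4  ≡⟨ +-cong-% {x ^ 2} {(x % 2) ^ 2} {y ^ 2} {(y % 2) ^ 2}
                                                (m^2%4≡[m%2]^2%4 x) (m^2%4≡[m%2]^2%4 y) ⟨
  (x ^ 2 + y ^ 2) % 4              ≡⟨ n∣m⇒m%n≡0 _ 4 4∣x²+y² ⟩
  0                                ∎)
  where open ≡-Reasoning
... | x%2≡0 , y%2≡0 = m%n≡0⇒n∣m x 2 x%2≡0 , m%n≡0⇒n∣m y 2 y%2≡0

even-prime≡2 : ∀ {p} → Prime p → 2 ∣ p → p ≡ 2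
even-prime≡2 pp 2∣p with prime⇒irreducible pp 2∣p
... | inj₂ 2≡p = sym 2≡p

prime%4≢1⇒rigid : ∀ {p} .{{_ : NonZero p}} → Prime p → p % 4 ≢ 1 → SumOfSquaresRigid p
prime%4≢1⇒rigid {p} pp p%4≢1 = by-residue (p % 4) refl
  where
  even⇒rigid : 2 ∣ p % 4 → SumOfSquaresRigid p
  even⇒rigid 2∣p%4 =
    subst SumOfSquaresRigid (sym (even-prime≡2 pp (∣n∣m%n⇒∣m (divides 2 refl) 2∣p%4))) rigid[2]
  by-residue : ∀ r → p % 4 ≡ r → SumOfSquaresRigid p
  by-residue 0 p%4≡0 = even⇒rigid (subst (2 ∣_) (sym p%4≡0) (divides 0 refl))
  by-residue 1 p%4≡1 = contradiction p%4≡1 p%4≢1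
  by-residue 2 p%4≡2 = even⇒rigid (subst (2 ∣_) (sym p%4≡2) (divides 1 refl))
  by-residue 3 p%4≡3 = prime≡3mod4⇒rigid pp p%4≡3
  by-residue (suc (suc (suc (suc r)))) p%4≡4+r =
    contradiction (subst (_< 4) p%4≡4+r (m%n<n p 4)) (m+n≮m 4 r)

rigid⇒p²∣x : ∀ {p} .{{_ : NonZero p}} → SumOfSquaresRigid p →
             ∀ x y → p ^ 4 ∣ x ^ 2 + y ^ 2 → p * p ∣ x
rigid⇒p²∣x {p} rigid x y p⁴∣x²+y² with rigid x y (∣-trans p²∣p⁴ p⁴∣x²+y²)
  where p²∣p⁴ = subst (p ^ 2 ∣_) (sym (^-distribˡ-+-* p 2 2)) (m∣m*n (p ^ 2))
... | divides x′ refl , divides y′ refl = *-monoˡ-∣ p (proj₁ (rigid x′ y′ p²∣x′²+y′²))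
  where
  instance _ = m^n≢0 p 2
  scale : ∀ a b p → a * p * (a * p * 1) + b * p * (b * p * 1)
                  ≡ (a * (a * 1) + b * (b * 1)) * (p * (p * 1))
  scale = solve-∀
  p²∣x′²+y′² : p ^ 2 ∣ x′ ^ 2 + y′ ^ 2
  p²∣x′²+y′² = *-cancelʳ-∣ (p ^ 2) (subst₂ _∣_ (^-distribˡ-+-* p 2 2) (scale x′ y′ p) p⁴∣x²+y²)

lemma3p6 : ∀ (a b d n : ℕ) → 0 < a → 0 < b → 0 < d → 0 < n →
           SquareFree (gcd a (b ^ 2)) →
           d * b ^ 4 ≡ a ^ 2 + n ^ 2 →
           ∀ p → Prime p → p ∣ b → p % 4 ≡ 1
lemma3p6 a b d n _ _ _ _ sf d*b⁴≡a²+n² p pp p∣b with p % 4 ≟ 1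
... | yes p%4≡1 = p%4≡1
... | no  p%4≢1 = contradiction (gcd-greatest p²∣a p²∣b²) (sf p (prime⇒>1 pp))
  where
  instance _ = prime⇒nonZero pp
  p⁴∣a²+n² : p ^ 4 ∣ a ^ 2 + n ^ 2
  p⁴∣a²+n² = subst (p ^ 4 ∣_) d*b⁴≡a²+n² (∣n⇒∣m*n d (^-monoˡ-∣ 4 p∣b))
  p²∣a : p * p ∣ a
  p²∣a = rigid⇒p²∣x (prime%4≢1⇒rigid pp p%4≢1) a n p⁴∣a²+n²
  p²∣b² : p * p ∣ b ^ 2
  p²∣b² = *-pres-∣ p∣b (∣m⇒∣m*n 1 p∣b)
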